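{- Let $D$ be an oriented graph with maximum degree at most $4$ such that no (weakly connected) component of $D$ is $2$-regular. Then for every unbalanced vertex $v\in V(D)$ there exists a good $v$-triple $(\sigma^v,\sigma_v,\sigma)$ of $D$.
   Context: An oriented graph is a digraph without loops, multiple arcs or directed $2$-cycles; degree = in-degree + out-degree. A digraph is $2$-regular if every vertex has in-degree and out-degree exactly $2$. A vertex $v$ is unbalanced if $\min\{d^+(v),d^-(v)\}\le 1$. For an ordering $\sigma$ of $V(D)$, an arc $uv$ is backward with respect to $\sigma$ if $v$ precedes $u$ in $\sigma$. A triple $(\sigma_1,\sigma_2,\sigma_3)$ of orderings of $V(D)$ is good if every arc of $D$ is backward with respect to exactly one of $\sigma_1,\sigma_2,\sigma_3$. A good triple $(\sigma_1,\sigma_2,\sigma_3)$ is a $v$-triple if $v$ is the first vertex of $\sigma_1$ and the last vertex of $\sigma_2$; it is then written $(\sigma^v,\sigma_v,\sigma)$. -}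

module Defs where

open import Data.Nat using (ℕ; zero; suc; _+_; _≤_; _⊓_)
open import Data.Bool using (Bool; true; false; T)
open import Data.Fin using (Fin) renaming (_<_ to _<ᶠ_; _≤_ to _≤ᶠ_)
open import Data.Fin.Permutation using (Permutation′; _⟨$⟩ʳ_)
open import Data.List using (List; length; filter; allFin)
open import Data.Product using (_×_)
open import Data.Sum using (_⊎_)
open import Relation.Nullary using (¬_)
open import Relation.Nullary.Decidable using (T?)
open import Relation.Binary.PropositionalEquality using (_≡_)

record OrientedGraph (n : ℕ) : Set where
  field
    arc       : Fin n → Fin n → Bool
    loopless  : ∀ v → arc v v ≡ false
    no2cycle  : ∀ u v → arc u v ≡ true → arc v u ≡ false

module _ {n : ℕ} (D : OrientedGraph n) where
  open OrientedGraph D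

  outdeg : Fin n → ℕ
  outdeg v = length (filter (λ u → T? (arc v u)) (allFin n))

  indeg : Fin n → ℕ
  indeg v = length (filter (λ u → T? (arc u v)) (allFin n))

  deg : Fin n → ℕ
  deg v = outdeg v + indeg v

  MaxDegreeAtMost : ℕ → Set
  MaxDegreeAtMost k = ∀ v → deg v ≤ k

  TwoRegularVertex : Fin n → Set
  TwoRegularVertex v = (outdeg v ≡ 2) × (indeg v ≡ 2)

  data WeaklyConnected (v : Fin n) : Fin n → Set where
    here : WeaklyConnected v v
    step : ∀ {u w} → WeaklyConnected v u →
           (arc u w ≡ true ⊎ arc w u ≡ true) → WeaklyConnected v w

  ComponentTwoRegular : Fin n → Set
  ComponentTwoRegular v = ∀ u → WeaklyConnected v u → TwoRegularVertex u

  NoComponentTwoRegular : Set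
  NoComponentTwoRegular = ∀ v → ¬ ComponentTwoRegular v

  Unbalanced : Fin n → Set
  Unbalanced v = outdeg v ⊓ indeg v ≤ 1

  -- An ordering σ of V(D) is a permutation; σ ⟨$⟩ʳ v is the position of v.
  Ordering : Set
  Ordering = Permutation′ n

  Backward : Ordering → Fin n → Fin n → Set
  Backward σ u v = (σ ⟨$⟩ʳ v) <ᶠ (σ ⟨$⟩ʳ u)

  GoodTriple : Ordering → Ordering → Ordering → Set
  GoodTriple σ₁ σ₂ σ₃ = ∀ u v → arc u v ≡ true →
      (Backward σ₁ u v × ¬ Backward σ₂ u v × ¬ Backward σ₃ u v)
    ⊎ (¬ Backward σ₁ u v × Backward σ₂ u v × ¬ Backward σ₃ u v)
    ⊎ (¬ Backward σ₁ u v × ¬ Backward σ₂ u v × Backward σ₃ u v)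

  IsFirst : Ordering → Fin n → Set
  IsFirst σ v = ∀ u → (σ ⟨$⟩ʳ v) ≤ᶠ (σ ⟨$⟩ʳ u)

  IsLast : Ordering → Fin n → Set
  IsLast σ v = ∀ u → (σ ⟨$⟩ʳ u) ≤ᶠ (σ ⟨$⟩ʳ v)

  VTriple : Fin n → Ordering → Ordering → Ordering → Set
  VTriple v σ₁ σ₂ σ₃ = GoodTriple σ₁ σ₂ σ₃ × IsFirst σ₁ v × IsLast σ₂ v

-- Induction on the vertex set S of an induced subdigraph D[S] of maximum degree 4 without 2-regular
-- components.  Delete the unbalanced vertex v: every neighbour of v has degree at most 3 in
-- D[S - v], so it is unbalanced there and not 2-regular, and D[S - v] again has no 2-regular
-- component.  In the new triple v is put first in σ₁ and last in σ₂, which makes its in-arcs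
-- backward in σ₁ and its out-arcs backward in σ₂; it remains to insert v into σ₃ after all its
-- in-neighbours and before all its out-neighbours.  With in- or out-degree 0 any good triple of
-- D[S - v] will do (one exists, as a non-2-regular vertex of degree at most 4 is unbalanced).  With a
-- unique in-neighbour u, rotate a u-triple (σ^u, σ_u, σ) of D[S - v] to (σ_u, σ, σ^u) and put v right
-- after u in σ^u, where u is first.  A unique out-neighbour w is symmetric: use (σ^w, σ, σ_w) and put
-- v right before w, which is last in σ_w.

module Submission where

open import Defs
open import Data.Nat using (ℕ; zero; suc; _+_; _≤_; _<_; _⊓_; _≤?_; _<ᵇ_; z≤n; s≤s; s≤s⁻¹; s<s⁻¹)
  renaming (_≟_ to _≟ℕ_)
open import Data.Nat.Properties
  using (≤-refl; ≤-reflexive; ≤-trans; ≤-antisym; <-irrefl; <-asym; <⇒≤; <⇒≢; ≤-<-trans; <-≤-trans; ≮⇒≥; ≰⇒>;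
         n≤1+n; n<1+n; m<n⇒m<1+n; m≤n⇒m≤1+n; ≤⇒≯; <-trans; <-cmp; ≤∧≢⇒<; ⊓-sel; m⊓n≤m; m⊓n≤n;
         +-mono-≤; +-mono-<-≤; +-mono-≤-<; +-monoˡ-≤; +-monoʳ-≤; +-cancelˡ-≤; +-cancelʳ-≤;
         <ᵇ⇒<; <⇒<ᵇ)
open import Data.Bool using (Bool; true; false)
open import Data.Bool.Properties using (T-≡)
open import Data.Fin using (Fin; zero; suc; fromℕ<; _≟_; punchOut) renaming (_<_ to _<ᶠ_)
open import Data.Fin.Properties using (toℕ-fromℕ<; any?; pigeonhole; punchOut-injective; ¬∀⟶∃¬)
  renaming (<⇒≢ to <ᶠ⇒≢)
open import Data.Fin.Permutation using (Permutation′; _⟨$⟩ʳ_; permutation)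
open import Data.Fin.Subset using (Subset; _∈_; _∉_; _⊆_; _⊂_; _∩_; _-_; ⊤; ∣_∣; Nonempty; Empty)
open import Data.Fin.Subset.Properties
  using (∈⊤; ∣⊤∣≡n; p⊆q⇒∣p∣≤∣q∣; _∈?_; nonempty?; Empty-unique; ∣⊥∣≡0; x∈p∩q⁺; x∈p∩q⁻; p─q⊆p;
         x∈p∧x≢y⇒x∈p-y; x∈p⇒∣p-x∣<∣p∣; p⊂q⇒∣p∣<∣q∣; ∩-identityˡ)
open import Data.List.Base using (length; filterᵇ)
import Data.List.Base as List
import Data.Vec.Base as Vec
open import Data.Vec.Base using (_∷_; there)
open import Data.List.Extrema.Nat using (max; xs≤max)
open import Data.List.Relation.Unary.All.Properties using (tabulate⁻)
open import Data.Vec.Properties using (lookup∘tabulate; []=⇒lookup; lookup⇒[]=)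
open import Data.Product using (Σ; ∃; _×_; _,_; proj₁; proj₂)
open import Data.Sum using (_⊎_; inj₁; inj₂)
open import Function using (_∘_; id; const; _⇔_; mk⇔; Equivalence)
open import Function.Definitions using (Injective)
open import Relation.Binary.Definitions using (tri<; tri≈; tri>)
open import Relation.Binary.PropositionalEquality using (_≡_; _≢_; refl; sym; trans; cong; cong₂; subst)
open import Relation.Nullary using (¬_; yes; no; contradiction; Dec)
open import Relation.Nullary.Decidable using (_→-dec_; _×-dec_; toSum; decidable-stable)

private
  variable
    n : ℕ

ExactlyOne : Set → Set → Set → Set
ExactlyOne A B C = (A × ¬ B × ¬ C) ⊎ (¬ A × B × ¬ C) ⊎ (¬ A × ¬ B × C)

module _ {A B C A′ B′ C′ : Set} where
  open Equivalence

  ExactlyOne-map : A ⇔ A′ → B ⇔ B′ → C ⇔ C′ → ExactlyOne A B C → ExactlyOne A′ B′ C′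
  ExactlyOne-map a b c (inj₁ (x , ¬y , ¬z)) = inj₁ (to a x , ¬y ∘ from b , ¬z ∘ from c)
  ExactlyOne-map a b c (inj₂ (inj₁ (¬x , y , ¬z))) = inj₂ (inj₁ (¬x ∘ from a , to b y , ¬z ∘ from c))
  ExactlyOne-map a b c (inj₂ (inj₂ (¬x , ¬y , z))) = inj₂ (inj₂ (¬x ∘ from a , ¬y ∘ from b , to c z))

module _ {A B C : Set} where

  ExactlyOne-rotate : ExactlyOne A B C → ExactlyOne B C A
  ExactlyOne-rotate (inj₁ (x , ¬y , ¬z)) = inj₂ (inj₂ (¬y , ¬z , x))
  ExactlyOne-rotate (inj₂ (inj₁ (¬x , y , ¬z))) = inj₁ (y , ¬z , ¬x)
  ExactlyOne-rotate (inj₂ (inj₂ (¬x , ¬y , z))) = inj₂ (inj₁ (¬y , z , ¬x))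

  ExactlyOne-swap₂₃ : ExactlyOne A B C → ExactlyOne A C B
  ExactlyOne-swap₂₃ (inj₁ (x , ¬y , ¬z)) = inj₁ (x , ¬z , ¬y)
  ExactlyOne-swap₂₃ (inj₂ (inj₁ (¬x , y , ¬z))) = inj₂ (inj₂ (¬x , ¬z , y))
  ExactlyOne-swap₂₃ (inj₂ (inj₂ (¬x , ¬y , z))) = inj₂ (inj₁ (¬x , z , ¬y))

∈-tabulate⁺ : ∀ {f : Fin n → Bool} {x} → f x ≡ true → x ∈ Vec.tabulate f
∈-tabulate⁺ {f = f} {x} fx = lookup⇒[]= x (Vec.tabulate f) (trans (lookup∘tabulate f x) fx)

∈-tabulate⁻ : ∀ {f : Fin n → Bool} {x} → x ∈ Vec.tabulate f → f x ≡ true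
∈-tabulate⁻ {f = f} {x} x∈ = trans (sym (lookup∘tabulate f x)) ([]=⇒lookup x∈)

x∉p-x : ∀ (p : Subset n) x → x ∉ p - x
x∉p-x (true ∷ p) zero ()
x∉p-x (false ∷ p) zero ()
x∉p-x (_ ∷ p) (suc x) (there x∈) = x∉p-x p x x∈

x∈p⇒0<∣p∣ : ∀ {p : Subset n} {x} → x ∈ p → 0 < ∣ p ∣
x∈p⇒0<∣p∣ x∈p = ≤-<-trans z≤n (x∈p⇒∣p-x∣<∣p∣ x∈p)

0<∣p∣⇒nonempty : ∀ {n} {p : Subset n} → 0 < ∣ p ∣ → Nonempty p
0<∣p∣⇒nonempty {n} {p} 0<∣p∣ with nonempty? p
... | yes ne = ne
... | no ¬ne = contradiction (trans (cong ∣_∣ (Empty-unique ¬ne)) (∣⊥∣≡0 n)) (<⇒≢ 0<∣p∣ ∘ sym)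

∣p∣≡1⇒nonempty : ∀ {p : Subset n} → ∣ p ∣ ≡ 1 → Nonempty p
∣p∣≡1⇒nonempty ∣p∣≡1 = 0<∣p∣⇒nonempty (subst (0 <_) (sym ∣p∣≡1) (s≤s z≤n))

∣p∣≡1⇒unique : ∀ {p : Subset n} {x y} → ∣ p ∣ ≡ 1 → x ∈ p → y ∈ p → x ≡ y
∣p∣≡1⇒unique {p = p} {x} {y} ∣p∣≡1 x∈p y∈p with y ≟ x
... | yes y≡x = sym y≡x
... | no y≢x = contradiction (<-≤-trans (x∈p⇒0<∣p∣ y∈p-x) (s≤s⁻¹ ∣p-x∣<1)) (<-irrefl refl)
  where
  y∈p-x : y ∈ p - x
  y∈p-x = x∈p∧x≢y⇒x∈p-y y∈p y≢x
  ∣p-x∣<1 : ∣ p - x ∣ < 1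
  ∣p-x∣<1 = subst (∣ p - x ∣ <_) ∣p∣≡1 (x∈p⇒∣p-x∣<∣p∣ x∈p)

∣p∣≡0⇒x∉p : ∀ {p : Subset n} {x} → ∣ p ∣ ≡ 0 → x ∉ p
∣p∣≡0⇒x∉p ∣p∣≡0 x∈p = <⇒≢ (x∈p⇒0<∣p∣ x∈p) (sym ∣p∣≡0)

∩-monoˡ-⊆ : ∀ {p q r : Subset n} → p ⊆ q → p ∩ r ⊆ q ∩ r
∩-monoˡ-⊆ {p = p} {r = r} p⊆q x∈ = let x∈p , x∈r = x∈p∩q⁻ p r x∈ in x∈p∩q⁺ (p⊆q x∈p , x∈r)

delete-⊆ : ∀ (p : Subset n) x → p - x ⊆ p
delete-⊆ p x = p─q⊆p p _

∩-delete-⊂ : ∀ (p q : Subset n) {x} → x ∈ p → x ∈ q → (p - x) ∩ q ⊂ p ∩ q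
∩-delete-⊂ p q {x} x∈p x∈q =
  ∩-monoˡ-⊆ (delete-⊆ p x) , x , x∈p∩q⁺ (x∈p , x∈q) , x∉p-x p x ∘ proj₁ ∘ x∈p∩q⁻ (p - x) q

length-filter-tabulate : ∀ {A : Set} (p : A → Bool) (h : Fin n → A) →
  length (filterᵇ p (List.tabulate h)) ≡ ∣ Vec.tabulate (p ∘ h) ∣
length-filter-tabulate {zero} p h = refl
length-filter-tabulate {suc n} p h with p (h zero)
... | true = cong suc (length-filter-tabulate p (h ∘ suc))
... | false = length-filter-tabulate p (h ∘ suc)

-- Orderings as injective keys

shift : ℕ → ℕ → ℕ
shift k m with k ≤? m
... | yes _ = suc m
... | no _ = m

<-shift : ∀ {k m} → k ≤ m → k < shift k m
<-shift {k} {m} k≤m with k ≤? m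
... | yes _ = s≤s k≤m
... | no k≰m = contradiction k≤m k≰m

shift-< : ∀ {k m} → m < k → shift k m < k
shift-< {k} {m} m<k with k ≤? m
... | yes k≤m = contradiction (<-≤-trans m<k k≤m) (<-irrefl refl)
... | no _ = m<k

shift≢ : ∀ k m → shift k m ≢ k
shift≢ k m with k ≤? m
... | yes k≤m = <⇒≢ (s≤s k≤m) ∘ sym
... | no k≰m = k≰m ∘ ≤-reflexive ∘ sym

shift-mono-< : ∀ k {a b} → a < b → shift k a < shift k b
shift-mono-< k {a} {b} a<b with k ≤? a | k ≤? b
... | yes _ | yes _ = s≤s a<b
... | yes k≤a | no k≰b = contradiction (≤-trans k≤a (<⇒≤ a<b)) k≰b
... | no _ | yes _ = m<n⇒m<1+n a<b
... | no _ | no _ = a<b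

shift-cancel-< : ∀ k {a b} → shift k a < shift k b → a < b
shift-cancel-< k {a} {b} lt with k ≤? a | k ≤? b
... | yes _ | yes _ = s<s⁻¹ lt
... | yes _ | no _ = ≤-trans (n≤1+n _) lt
... | no k≰a | yes k≤b = <-≤-trans (≰⇒> k≰a) k≤b
... | no _ | no _ = lt

shift-injective : ∀ k {a b} → shift k a ≡ shift k b → a ≡ b
shift-injective k {a} {b} eq with <-cmp a b
... | tri< a<b _ _ = contradiction eq (<⇒≢ (shift-mono-< k a<b))
... | tri≈ _ a≡b _ = a≡b
... | tri> _ _ b<a = contradiction (sym eq) (<⇒≢ (shift-mono-< k b<a))

-- x precedes y iff key x < key y; keys outside S are irrelevant.
record OrderingOn (S : Subset n) : Set where
  constructor ordering
  field
    key       : Fin n → ℕ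
    injective : ∀ {x y} → x ∈ S → y ∈ S → key x ≡ key y → x ≡ y

open OrderingOn public

Before : ∀ {S : Subset n} → OrderingOn S → Fin n → Fin n → Set
Before σ x y = key σ x < key σ y

insertAt : Fin n → ℕ → (Fin n → ℕ) → Fin n → ℕ
insertAt v k r x with x ≟ v
... | yes _ = k
... | no _ = shift k (r x)

insertAt-self : ∀ (v : Fin n) k r → insertAt v k r v ≡ k
insertAt-self v k r with v ≟ v
... | yes _ = refl
... | no v≢v = contradiction refl v≢v

insertAt-other : ∀ {v x : Fin n} k r → x ≢ v → insertAt v k r x ≡ shift k (r x)
insertAt-other {v = v} {x} k r x≢v with x ≟ v
... | yes x≡v = contradiction x≡v x≢v
... | no _ = refl

insertAt-other≢self : ∀ {v x : Fin n} k r → x ≢ v → insertAt v k r x ≢ insertAt v k r v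
insertAt-other≢self {v = v} k r x≢v rewrite insertAt-other k r x≢v | insertAt-self v k r = shift≢ k _

module _ {S : Subset n} {v : Fin n} (k : ℕ) (σ : OrderingOn (S - v)) where

  insert : OrderingOn S
  insert = ordering (insertAt v k (key σ)) injective′
    where
    injective′ : ∀ {x y} → x ∈ S → y ∈ S → insertAt v k (key σ) x ≡ insertAt v k (key σ) y → x ≡ y
    injective′ {x} {y} x∈S y∈S eq with toSum (x ≟ v) | toSum (y ≟ v)
    ... | inj₁ refl | inj₁ refl = refl
    ... | inj₁ refl | inj₂ y≢v = contradiction (sym eq) (insertAt-other≢self k (key σ) y≢v)
    ... | inj₂ x≢v | inj₁ refl = contradiction eq (insertAt-other≢self k (key σ) x≢v)
    ... | inj₂ x≢v | inj₂ y≢v = injective σ (x∈p∧x≢y⇒x∈p-y x∈S x≢v) (x∈p∧x≢y⇒x∈p-y y∈S y≢v)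
      (shift-injective k (trans (sym (insertAt-other k (key σ) x≢v))
                               (trans eq (insertAt-other k (key σ) y≢v))))

  insert-<⇔ : ∀ {x y} → x ≢ v → y ≢ v → Before σ x y ⇔ Before insert x y
  insert-<⇔ x≢v y≢v rewrite insertAt-other k (key σ) x≢v | insertAt-other k (key σ) y≢v =
    mk⇔ (shift-mono-< k) (shift-cancel-< k)

  insert-before : ∀ {x} → x ≢ v → k ≤ key σ x → Before insert v x
  insert-before x≢v k≤x rewrite insertAt-self v k (key σ) | insertAt-other k (key σ) x≢v = <-shift k≤x

  insert-after : ∀ {x} → x ≢ v → key σ x < k → Before insert x v
  insert-after x≢v x<k rewrite insertAt-self v k (key σ) | insertAt-other k (key σ) x≢v = shift-< x<k

injective⇒surjective : ∀ {f : Fin n → Fin n} → Injective _≡_ _≡_ f → ∀ i → ∃ λ x → f x ≡ i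
injective⇒surjective {suc m} {f} f-injective i with any? (λ x → f x ≟ i)
... | yes hit = hit
... | no miss =
  let a , b , a<b , eq = pigeonhole (n<1+n m) (λ x → punchOut (miss ∘ (x ,_) ∘ sym))
  in contradiction (f-injective (punchOut-injective {i = i} _ _ eq)) (<ᶠ⇒≢ a<b)

injective⇒permutation : (f : Fin n → Fin n) → Injective _≡_ _≡_ f → Permutation′ n
injective⇒permutation f f-injective =
  permutation f (proj₁ ∘ surjective) (proj₂ ∘ surjective) (λ x → f-injective (proj₂ (surjective (f x))))
  where
  surjective : ∀ i → ∃ λ x → f x ≡ i
  surjective = injective⇒surjective f-injective

module _ (r : Fin n → ℕ) where

  below : Fin n → Subset n
  below x = Vec.tabulate (λ y → r y <ᵇ r x)

  ∈-below⁺ : ∀ {x y} → r y < r x → y ∈ below x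
  ∈-below⁺ ry<rx = ∈-tabulate⁺ (Equivalence.to T-≡ (<⇒<ᵇ ry<rx))

  ∈-below⁻ : ∀ {x y} → y ∈ below x → r y < r x
  ∈-below⁻ {x} {y} y∈ = <ᵇ⇒< (r y) (r x) (Equivalence.from T-≡ (∈-tabulate⁻ y∈))

  ∣below∣<n : ∀ x → ∣ below x ∣ < n
  ∣below∣<n x = subst (∣ below x ∣ <_) (∣⊤∣≡n n)
    (p⊂q⇒∣p∣<∣q∣ ((λ _ → ∈⊤) , x , ∈⊤ , <-irrefl refl ∘ ∈-below⁻))

  rank : Fin n → Fin n
  rank x = fromℕ< (∣below∣<n x)

  rank-mono-< : ∀ {x y} → r x < r y → rank x <ᶠ rank y
  rank-mono-< {x} {y} rx<ry rewrite toℕ-fromℕ< (∣below∣<n x) | toℕ-fromℕ< (∣below∣<n y) =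
    p⊂q⇒∣p∣<∣q∣ ( (λ z∈ → ∈-below⁺ (<-trans (∈-below⁻ z∈) rx<ry))
                , x , ∈-below⁺ rx<ry , <-irrefl refl ∘ ∈-below⁻)

  module _ (r-injective : Injective _≡_ _≡_ r) where

    rank-cancel-< : ∀ {x y} → rank x <ᶠ rank y → r x < r y
    rank-cancel-< {x} {y} rank< with <-cmp (r x) (r y)
    ... | tri< lt _ _ = lt
    ... | tri≈ _ eq _ rewrite r-injective eq = contradiction rank< (<-irrefl refl)
    ... | tri> _ _ gt = contradiction (rank-mono-< gt) (<-asym rank<)

    rank-injective : Injective _≡_ _≡_ rank
    rank-injective {x} {y} eq with <-cmp (r x) (r y)
    ... | tri< lt _ _ = contradiction eq (<ᶠ⇒≢ (rank-mono-< lt))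
    ... | tri≈ _ rx≡ry _ = r-injective rx≡ry
    ... | tri> _ _ gt = contradiction (sym eq) (<ᶠ⇒≢ (rank-mono-< gt))

    rankPermutation : Permutation′ n
    rankPermutation = injective⇒permutation rank rank-injective

    rankPermutation-<⇔ : ∀ {x y} → r x < r y ⇔ rankPermutation ⟨$⟩ʳ x <ᶠ rankPermutation ⟨$⟩ʳ y
    rankPermutation-<⇔ = mk⇔ rank-mono-< rank-cancel-<

bound : (Fin n → ℕ) → ℕ
bound r = suc (max 0 (List.tabulate r))

<bound : ∀ (r : Fin n → ℕ) x → r x < bound r
<bound r x = s≤s (tabulate⁻ (xs≤max 0 (List.tabulate r)) x)

both≡2 : ∀ {o i} → 2 ≤ o → 2 ≤ i → o + i ≤ 4 → o ≡ 2 × i ≡ 2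
both≡2 {o} {i} 2≤o 2≤i sum≤4 =
  ≤-antisym (+-cancelʳ-≤ 2 o 2 (≤-trans (+-monoʳ-≤ o 2≤i) sum≤4)) 2≤o ,
  ≤-antisym (+-cancelˡ-≤ 2 i 2 (≤-trans (+-monoˡ-≤ i 2≤o) sum≤4)) 2≤i

⊓≤1⊎both≡2 : ∀ {o i} → o + i ≤ 4 → o ⊓ i ≤ 1 ⊎ (o ≡ 2 × i ≡ 2)
⊓≤1⊎both≡2 {o} {i} sum≤4 with o ⊓ i ≤? 1
... | yes ⊓≤1 = inj₁ ⊓≤1
... | no ⊓≰1 = inj₂ (both≡2 (≤-trans (≰⇒> ⊓≰1) (m⊓n≤m o i)) (≤-trans (≰⇒> ⊓≰1) (m⊓n≤n o i)) sum≤4)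

sum≤3⇒¬both≡2 : ∀ {o i} → o + i ≤ 3 → ¬ (o ≡ 2 × i ≡ 2)
sum≤3⇒¬both≡2 (s≤s (s≤s (s≤s ()))) (refl , refl)

sum≤3⇒⊓≤1 : ∀ {o i} → o + i ≤ 3 → o ⊓ i ≤ 1
sum≤3⇒⊓≤1 sum≤3 with ⊓≤1⊎both≡2 (m≤n⇒m≤1+n sum≤3)
... | inj₁ ⊓≤1 = ⊓≤1
... | inj₂ both = contradiction both (sum≤3⇒¬both≡2 sum≤3)

⊓≤1⇒≤1 : ∀ {o i} → o ⊓ i ≤ 1 → o ≤ 1 ⊎ i ≤ 1
⊓≤1⇒≤1 {o} {i} ⊓≤1 with ⊓-sel o i
... | inj₁ o⊓i≡o = inj₁ (subst (_≤ 1) o⊓i≡o ⊓≤1)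
... | inj₂ o⊓i≡i = inj₂ (subst (_≤ 1) o⊓i≡i ⊓≤1)

≤1⇒≡0⊎≡1 : ∀ {m} → m ≤ 1 → m ≡ 0 ⊎ m ≡ 1
≤1⇒≡0⊎≡1 z≤n = inj₁ refl
≤1⇒≡0⊎≡1 (s≤s z≤n) = inj₂ refl

-- Induced subdigraphs

module Digraph {n} (D : OrientedGraph n) where
  open OrientedGraph D

  arc⇒≢ : ∀ {x y} → arc x y ≡ true → x ≢ y
  arc⇒≢ {x} xy refl with () ← trans (sym xy) (loopless x)

  arc⇒¬arc : ∀ {x y} → arc x y ≡ true → arc y x ≢ true
  arc⇒¬arc {x} {y} xy yx with () ← trans (sym yx) (no2cycle x y xy)

  N⁺ N⁻ : Fin n → Subset n
  N⁺ v = Vec.tabulate (arc v)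
  N⁻ v = Vec.tabulate (λ u → arc u v)

  outdegIn indegIn degIn : Subset n → Fin n → ℕ
  outdegIn S v = ∣ S ∩ N⁺ v ∣
  indegIn S v = ∣ S ∩ N⁻ v ∣
  degIn S v = outdegIn S v + indegIn S v

  MaxDegreeIn : Subset n → ℕ → Set
  MaxDegreeIn S k = ∀ z → degIn S z ≤ k

  UnbalancedIn : Subset n → Fin n → Set
  UnbalancedIn S v = outdegIn S v ⊓ indegIn S v ≤ 1

  TwoRegularIn : Subset n → Fin n → Set
  TwoRegularIn S v = outdegIn S v ≡ 2 × indegIn S v ≡ 2

  Adjacent : Fin n → Fin n → Set
  Adjacent u w = arc u w ≡ true ⊎ arc w u ≡ true

  data Walk (S : Subset n) (x : Fin n) : Fin n → Set where
    here : Walk S x x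
    step : ∀ {y z} → Walk S x y → z ∈ S → Adjacent y z → Walk S x z

  walk-target-∈ : ∀ {S x y} → x ∈ S → Walk S x y → y ∈ S
  walk-target-∈ x∈S here = x∈S
  walk-target-∈ _ (step _ z∈S _) = z∈S

  NoTwoRegularComponentIn : Subset n → Set
  NoTwoRegularComponentIn S = ∀ {x} → x ∈ S → ¬ (∀ {y} → Walk S x y → TwoRegularIn S y)

  outNeighbour⁺ : ∀ {S v w} → w ∈ S → arc v w ≡ true → w ∈ S ∩ N⁺ v
  outNeighbour⁺ w∈S vw = x∈p∩q⁺ (w∈S , ∈-tabulate⁺ vw)

  outNeighbour⁻ : ∀ {S v w} → w ∈ S ∩ N⁺ v → w ∈ S × arc v w ≡ true
  outNeighbour⁻ {S} {v} w∈ = let w∈S , w∈N⁺v = x∈p∩q⁻ S (N⁺ v) w∈ in w∈S , ∈-tabulate⁻ w∈N⁺v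

  inNeighbour⁺ : ∀ {S v x} → x ∈ S → arc x v ≡ true → x ∈ S ∩ N⁻ v
  inNeighbour⁺ x∈S xv = x∈p∩q⁺ (x∈S , ∈-tabulate⁺ xv)

  inNeighbour⁻ : ∀ {S v x} → x ∈ S ∩ N⁻ v → x ∈ S × arc x v ≡ true
  inNeighbour⁻ {S} {v} x∈ = let x∈S , x∈N⁻v = x∈p∩q⁻ S (N⁻ v) x∈ in x∈S , ∈-tabulate⁻ x∈N⁻v

  outdegIn-mono : ∀ {S T} → S ⊆ T → ∀ z → outdegIn S z ≤ outdegIn T z
  outdegIn-mono S⊆T z = p⊆q⇒∣p∣≤∣q∣ (∩-monoˡ-⊆ S⊆T)

  indegIn-mono : ∀ {S T} → S ⊆ T → ∀ z → indegIn S z ≤ indegIn T z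
  indegIn-mono S⊆T z = p⊆q⇒∣p∣≤∣q∣ (∩-monoˡ-⊆ S⊆T)

  degIn-delete-< : ∀ {S v z} → v ∈ S → Adjacent z v → degIn (S - v) z < degIn S z
  degIn-delete-< {S} {v} {z} v∈S (inj₁ zv) =
    +-mono-<-≤ (p⊂q⇒∣p∣<∣q∣ (∩-delete-⊂ S (N⁺ z) v∈S (∈-tabulate⁺ zv))) (indegIn-mono (delete-⊆ S v) z)
  degIn-delete-< {S} {v} {z} v∈S (inj₂ vz) =
    +-mono-≤-< (outdegIn-mono (delete-⊆ S v) z) (p⊂q⇒∣p∣<∣q∣ (∩-delete-⊂ S (N⁻ z) v∈S (∈-tabulate⁺ vz)))

  maxDegree-delete : ∀ {S v k} → MaxDegreeIn S k → MaxDegreeIn (S - v) k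
  maxDegree-delete {S} {v} md z =
    ≤-trans (+-mono-≤ (outdegIn-mono (delete-⊆ S v) z) (indegIn-mono (delete-⊆ S v) z)) (md z)

  neighbour-degIn≤3 : ∀ {S v z} → MaxDegreeIn S 4 → v ∈ S → Adjacent z v → degIn (S - v) z ≤ 3
  neighbour-degIn≤3 {z = z} md v∈S adj = s≤s⁻¹ (<-≤-trans (degIn-delete-< v∈S adj) (md z))

  neighbour-unbalanced : ∀ {S v z} → MaxDegreeIn S 4 → v ∈ S → Adjacent z v → UnbalancedIn (S - v) z
  neighbour-unbalanced md v∈S adj = sum≤3⇒⊓≤1 (neighbour-degIn≤3 md v∈S adj)

  twoRegular-undelete : ∀ {S v y} → MaxDegreeIn S 4 → TwoRegularIn (S - v) y → TwoRegularIn S y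
  twoRegular-undelete {S} {v} {y} md (out≡2 , in≡2) =
    both≡2 (subst (_≤ _) out≡2 (outdegIn-mono (delete-⊆ S v) y))
           (subst (_≤ _) in≡2 (indegIn-mono (delete-⊆ S v) y))
           (md y)

  walk-delete : ∀ {S v x y} → Walk S x y → Walk (S - v) x y ⊎ ∃ λ z → Walk (S - v) x z × Adjacent z v
  walk-delete here = inj₁ here
  walk-delete {v = v} (step {z = z} w z∈S adj) with walk-delete w
  ... | inj₂ hit = inj₂ hit
  ... | inj₁ w′ with toSum (z ≟ v)
  ...   | inj₁ refl = inj₂ (_ , w′ , adj)
  ...   | inj₂ z≢v = inj₁ (step w′ (x∈p∧x≢y⇒x∈p-y z∈S z≢v) adj)

  noTwoRegularComponent-delete : ∀ {S v} → MaxDegreeIn S 4 → v ∈ S →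
    NoTwoRegularComponentIn S → NoTwoRegularComponentIn (S - v)
  noTwoRegularComponent-delete {S} {v} md v∈S noReg {x} x∈S-v allReg = noReg (delete-⊆ S v x∈S-v) allRegS
    where
    allRegS : ∀ {y} → Walk S x y → TwoRegularIn S y
    allRegS {y} w with walk-delete {v = v} w
    ... | inj₁ w′ = twoRegular-undelete {S} {v} {y} md (allReg w′)
    ... | inj₂ (z , w′ , adj) = contradiction (allReg w′) (sum≤3⇒¬both≡2 (neighbour-degIn≤3 md v∈S adj))

  nonTwoRegular-exists : ∀ {S x} → NoTwoRegularComponentIn S → x ∈ S → ∃ λ y → y ∈ S × ¬ TwoRegularIn S y
  nonTwoRegular-exists {S} noReg x∈S =
    y , decidable-stable (y ∈? S) (λ y∉S → ¬Py (λ y∈S → contradiction y∈S y∉S)) , ¬Py ∘ const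
    where
    P : Fin n → Set
    P y = y ∈ S → TwoRegularIn S y
    P? : ∀ y → Dec (P y)
    P? y = (y ∈? S) →-dec ((outdegIn S y ≟ℕ 2) ×-dec (indegIn S y ≟ℕ 2))
    counterexample : ∃ λ y → ¬ P y
    counterexample = ¬∀⟶∃¬ n P P? (λ all → noReg x∈S (all _ ∘ walk-target-∈ x∈S))
    y : Fin n
    y = proj₁ counterexample
    ¬Py : ¬ P y
    ¬Py = proj₂ counterexample

  unbalanced-exists : ∀ {S x} → MaxDegreeIn S 4 → NoTwoRegularComponentIn S → x ∈ S →
    ∃ λ y → y ∈ S × UnbalancedIn S y
  unbalanced-exists md noReg x∈S with nonTwoRegular-exists noReg x∈S
  ... | y , y∈S , ¬twoReg with ⊓≤1⊎both≡2 (md y)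
  ...   | inj₁ unb = y , y∈S , unb
  ...   | inj₂ twoReg = contradiction twoReg ¬twoReg

  record GoodTripleOn (S : Subset n) : Set where
    constructor goodTriple
    field
      σ₁ σ₂ σ₃ : OrderingOn S
      good     : ∀ {a b} → a ∈ S → b ∈ S → arc a b ≡ true →
                 ExactlyOne (Before σ₁ b a) (Before σ₂ b a) (Before σ₃ b a)

  open GoodTripleOn

  record VTripleOn (S : Subset n) (v : Fin n) : Set where
    field
      triple : GoodTripleOn S
      first  : ∀ {u} → u ∈ S → key (σ₁ triple) v ≤ key (σ₁ triple) u
      last   : ∀ {u} → u ∈ S → key (σ₂ triple) u ≤ key (σ₂ triple) v

  rotate : ∀ {S} → GoodTripleOn S → GoodTripleOn S
  rotate (goodTriple σ₁ σ₂ σ₃ good) = goodTriple σ₂ σ₃ σ₁ λ a∈S b∈S ab → ExactlyOne-rotate (good a∈S b∈S ab)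

  swap₂₃ : ∀ {S} → GoodTripleOn S → GoodTripleOn S
  swap₂₃ (goodTriple σ₁ σ₂ σ₃ good) = goodTriple σ₁ σ₃ σ₂ λ a∈S b∈S ab → ExactlyOne-swap₂₃ (good a∈S b∈S ab)

  emptyTriple : ∀ {S} → Empty S → GoodTripleOn S
  emptyTriple empty = goodTriple σ σ σ λ a∈S → contradiction (_ , a∈S) empty
    where
    σ : OrderingOn _
    σ = ordering (λ _ → 0) λ x∈S → contradiction (_ , x∈S) empty

  extend : ∀ {S v} → v ∈ S → (τ : GoodTripleOn (S - v)) (k : ℕ) →
    (∀ {w} → w ∈ S → arc v w ≡ true → k ≤ key (σ₃ τ) w) →
    (∀ {x} → x ∈ S → arc x v ≡ true → key (σ₃ τ) x < k) →
    VTripleOn S v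
  extend {S} {v} v∈S τ k out-after in-before =
    record { triple = goodTriple τ₁ τ₂ τ₃ good′ ; first = first′ ; last = last′ }
    where
    τ₁ τ₂ τ₃ : OrderingOn S
    τ₁ = insert 0 (σ₁ τ)
    τ₂ = insert (bound (key (σ₂ τ))) (σ₂ τ)
    τ₃ = insert k (σ₃ τ)

    first′ : ∀ {u} → u ∈ S → key τ₁ v ≤ key τ₁ u
    first′ {u} _ with toSum (u ≟ v)
    ... | inj₁ refl = ≤-refl
    ... | inj₂ u≢v = <⇒≤ (insert-before 0 (σ₁ τ) u≢v z≤n)

    last′ : ∀ {u} → u ∈ S → key τ₂ u ≤ key τ₂ v
    last′ {u} _ with toSum (u ≟ v)
    ... | inj₁ refl = ≤-refl
    ... | inj₂ u≢v = <⇒≤ (insert-after _ (σ₂ τ) u≢v (<bound (key (σ₂ τ)) u))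

    good′ : ∀ {a b} → a ∈ S → b ∈ S → arc a b ≡ true →
            ExactlyOne (Before τ₁ b a) (Before τ₂ b a) (Before τ₃ b a)
    good′ {a} {b} a∈S b∈S ab with toSum (a ≟ v) | toSum (b ≟ v)
    ... | inj₁ refl | inj₁ refl = contradiction refl (arc⇒≢ ab)
    ... | inj₁ refl | inj₂ b≢v = inj₂ (inj₁
          ( <-asym (insert-before 0 (σ₁ τ) b≢v z≤n)
          , insert-after _ (σ₂ τ) b≢v (<bound (key (σ₂ τ)) b)
          , <-asym (insert-before k (σ₃ τ) b≢v (out-after b∈S ab))))
    ... | inj₂ a≢v | inj₁ refl = inj₁
          ( insert-before 0 (σ₁ τ) a≢v z≤n
          , <-asym (insert-after _ (σ₂ τ) a≢v (<bound (key (σ₂ τ)) a))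
          , <-asym (insert-after k (σ₃ τ) a≢v (in-before a∈S ab)))
    ... | inj₂ a≢v | inj₂ b≢v = ExactlyOne-map
          (insert-<⇔ 0 (σ₁ τ) b≢v a≢v) (insert-<⇔ _ (σ₂ τ) b≢v a≢v) (insert-<⇔ k (σ₃ τ) b≢v a≢v)
          (good τ (x∈p∧x≢y⇒x∈p-y a∈S a≢v) (x∈p∧x≢y⇒x∈p-y b∈S b≢v) ab)

  HasVTriples : Subset n → Set
  HasVTriples T = ∀ {u} → u ∈ T → UnbalancedIn T u → VTripleOn T u

  extendIndeg0 : ∀ {S v} → v ∈ S → indegIn S v ≡ 0 → GoodTripleOn (S - v) → VTripleOn S v
  extendIndeg0 v∈S in≡0 τ =
    extend v∈S τ 0 (λ _ _ → z≤n) (λ x∈S xv → contradiction (inNeighbour⁺ x∈S xv) (∣p∣≡0⇒x∉p in≡0))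

  extendOutdeg0 : ∀ {S v} → v ∈ S → outdegIn S v ≡ 0 → GoodTripleOn (S - v) → VTripleOn S v
  extendOutdeg0 v∈S out≡0 τ =
    extend v∈S τ (bound (key (σ₃ τ))) (λ w∈S vw → contradiction (outNeighbour⁺ w∈S vw) (∣p∣≡0⇒x∉p out≡0))
      (λ {x} _ _ → <bound (key (σ₃ τ)) x)

  extendIndeg1 : ∀ {S v} → MaxDegreeIn S 4 → v ∈ S → indegIn S v ≡ 1 → HasVTriples (S - v) → VTripleOn S v
  extendIndeg1 {S} {v} md v∈S in≡1 ih with ∣p∣≡1⇒nonempty in≡1
  ... | u , u∈S∩N⁻v = extend v∈S (rotate triple) (suc (key σ u)) out-after in-before
    where
    u∈S : u ∈ S
    u∈S = proj₁ (inNeighbour⁻ u∈S∩N⁻v)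
    uv : arc u v ≡ true
    uv = proj₂ (inNeighbour⁻ u∈S∩N⁻v)
    u∈S-v : u ∈ S - v
    u∈S-v = x∈p∧x≢y⇒x∈p-y u∈S (arc⇒≢ uv)
    t : VTripleOn (S - v) u
    t = ih u∈S-v (neighbour-unbalanced md v∈S (inj₁ uv))
    open VTripleOn t
    σ : OrderingOn (S - v)
    σ = σ₁ triple
    out-after : ∀ {w} → w ∈ S → arc v w ≡ true → suc (key σ u) ≤ key σ w
    out-after {w} w∈S vw = ≤∧≢⇒< (first w∈S-v) (u≢w ∘ injective σ u∈S-v w∈S-v)
      where
      w∈S-v : w ∈ S - v
      w∈S-v = x∈p∧x≢y⇒x∈p-y w∈S (arc⇒≢ vw ∘ sym)
      u≢w : u ≢ w
      u≢w refl = arc⇒¬arc uv vw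
    in-before : ∀ {x} → x ∈ S → arc x v ≡ true → key σ x < suc (key σ u)
    in-before x∈S xv rewrite ∣p∣≡1⇒unique in≡1 (inNeighbour⁺ x∈S xv) u∈S∩N⁻v = ≤-refl

  extendOutdeg1 : ∀ {S v} → MaxDegreeIn S 4 → v ∈ S → outdegIn S v ≡ 1 → HasVTriples (S - v) → VTripleOn S v
  extendOutdeg1 {S} {v} md v∈S out≡1 ih with ∣p∣≡1⇒nonempty out≡1
  ... | w , w∈S∩N⁺v = extend v∈S (swap₂₃ triple) (key σ w) out-after in-before
    where
    w∈S : w ∈ S
    w∈S = proj₁ (outNeighbour⁻ w∈S∩N⁺v)
    vw : arc v w ≡ true
    vw = proj₂ (outNeighbour⁻ w∈S∩N⁺v)
    w∈S-v : w ∈ S - v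
    w∈S-v = x∈p∧x≢y⇒x∈p-y w∈S (arc⇒≢ vw ∘ sym)
    t : VTripleOn (S - v) w
    t = ih w∈S-v (neighbour-unbalanced md v∈S (inj₂ vw))
    open VTripleOn t
    σ : OrderingOn (S - v)
    σ = σ₂ triple
    out-after : ∀ {w′} → w′ ∈ S → arc v w′ ≡ true → key σ w ≤ key σ w′
    out-after w′∈S vw′ rewrite ∣p∣≡1⇒unique out≡1 (outNeighbour⁺ w′∈S vw′) w∈S∩N⁺v = ≤-refl
    in-before : ∀ {x} → x ∈ S → arc x v ≡ true → key σ x < key σ w
    in-before {x} x∈S xv = ≤∧≢⇒< (last x∈S-v) (x≢w ∘ injective σ x∈S-v w∈S-v)
      where
      x∈S-v : x ∈ S - v
      x∈S-v = x∈p∧x≢y⇒x∈p-y x∈S (arc⇒≢ xv)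
      x≢w : x ≢ w
      x≢w refl = arc⇒¬arc vw xv

  extendUnbalanced : ∀ {S v} → MaxDegreeIn S 4 → v ∈ S → UnbalancedIn S v →
    GoodTripleOn (S - v) → HasVTriples (S - v) → VTripleOn S v
  extendUnbalanced md v∈S unb τ ih with ⊓≤1⇒≤1 unb
  ... | inj₁ out≤1 with ≤1⇒≡0⊎≡1 out≤1
  ...   | inj₁ out≡0 = extendOutdeg0 v∈S out≡0 τ
  ...   | inj₂ out≡1 = extendOutdeg1 md v∈S out≡1 ih
  extendUnbalanced md v∈S unb τ ih | inj₂ in≤1 with ≤1⇒≡0⊎≡1 in≤1
  ...   | inj₁ in≡0 = extendIndeg0 v∈S in≡0 τ
  ...   | inj₂ in≡1 = extendIndeg1 md v∈S in≡1 ih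

  mutual
    vTripleOn : ∀ k {S} → ∣ S ∣ ≤ k → MaxDegreeIn S 4 → NoTwoRegularComponentIn S →
      ∀ {v} → v ∈ S → UnbalancedIn S v → VTripleOn S v
    vTripleOn zero ∣S∣≤0 _ _ v∈S _ = contradiction (<-≤-trans (x∈p⇒0<∣p∣ v∈S) ∣S∣≤0) (<-irrefl refl)
    vTripleOn (suc k) {S} ∣S∣≤1+k md noReg {v} v∈S unb =
      extendUnbalanced md v∈S unb (goodTripleOn k ∣S-v∣≤k md′ noReg′) (vTripleOn k ∣S-v∣≤k md′ noReg′)
      where
      ∣S-v∣≤k : ∣ S - v ∣ ≤ k
      ∣S-v∣≤k = s≤s⁻¹ (<-≤-trans (x∈p⇒∣p-x∣<∣p∣ v∈S) ∣S∣≤1+k)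
      md′ : MaxDegreeIn (S - v) 4
      md′ = maxDegree-delete {S} {v} md
      noReg′ : NoTwoRegularComponentIn (S - v)
      noReg′ = noTwoRegularComponent-delete md v∈S noReg

    goodTripleOn : ∀ k {S} → ∣ S ∣ ≤ k → MaxDegreeIn S 4 → NoTwoRegularComponentIn S → GoodTripleOn S
    goodTripleOn k {S} ∣S∣≤k md noReg with nonempty? S
    ... | no empty = emptyTriple empty
    ... | yes (_ , x∈S) with unbalanced-exists md noReg x∈S
    ...   | _ , y∈S , unb = VTripleOn.triple (vTripleOn k ∣S∣≤k md noReg y∈S unb)

  outdeg≡outdegIn⊤ : ∀ v → outdeg D v ≡ outdegIn ⊤ v
  outdeg≡outdegIn⊤ v = trans (length-filter-tabulate (arc v) id) (cong ∣_∣ (sym (∩-identityˡ (N⁺ v))))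

  indeg≡indegIn⊤ : ∀ v → indeg D v ≡ indegIn ⊤ v
  indeg≡indegIn⊤ v = trans (length-filter-tabulate (λ u → arc u v) id) (cong ∣_∣ (sym (∩-identityˡ (N⁻ v))))

  maxDegreeIn⊤ : ∀ {k} → MaxDegreeAtMost D k → MaxDegreeIn ⊤ k
  maxDegreeIn⊤ {k} md z = subst (_≤ k) (cong₂ _+_ (outdeg≡outdegIn⊤ z) (indeg≡indegIn⊤ z)) (md z)

  unbalancedIn⊤ : ∀ {v} → Unbalanced D v → UnbalancedIn ⊤ v
  unbalancedIn⊤ {v} = subst (_≤ 1) (cong₂ _⊓_ (outdeg≡outdegIn⊤ v) (indeg≡indegIn⊤ v))

  walk⊤ : ∀ {x y} → WeaklyConnected D x y → Walk ⊤ x y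
  walk⊤ here = here
  walk⊤ (step w adj) = step (walk⊤ w) ∈⊤ adj

  noTwoRegularComponentIn⊤ : NoComponentTwoRegular D → NoTwoRegularComponentIn ⊤
  noTwoRegularComponentIn⊤ noReg {x} _ allReg = noReg x λ y w →
    let out≡2 , in≡2 = allReg (walk⊤ w) in trans (outdeg≡outdegIn⊤ y) out≡2 , trans (indeg≡indegIn⊤ y) in≡2

  toOrdering : OrderingOn ⊤ → Ordering D
  toOrdering σ = rankPermutation (key σ) (injective σ ∈⊤ ∈⊤)

  before⇔backward : ∀ (σ : OrderingOn ⊤) {u v} → Before σ v u ⇔ Backward D (toOrdering σ) u v
  before⇔backward σ = rankPermutation-<⇔ (key σ) (injective σ ∈⊤ ∈⊤)

  toVTriple : ∀ {v} → VTripleOn ⊤ v →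
    Σ (Ordering D) λ π₁ → Σ (Ordering D) λ π₂ → Σ (Ordering D) λ π₃ → VTriple D v π₁ π₂ π₃
  toVTriple {v} t = π σ₁ , π σ₂ , π σ₃ , good′ , first′ , last′
    where
    open VTripleOn t
    π : (GoodTripleOn ⊤ → OrderingOn ⊤) → Ordering D
    π σ = toOrdering (σ triple)
    good′ : GoodTriple D (π σ₁) (π σ₂) (π σ₃)
    good′ a b ab = ExactlyOne-map (before⇔backward (σ₁ triple)) (before⇔backward (σ₂ triple))
      (before⇔backward (σ₃ triple)) (good triple ∈⊤ ∈⊤ ab)
    first′ : IsFirst D (π σ₁) v
    first′ u = ≮⇒≥ (≤⇒≯ (first ∈⊤) ∘ Equivalence.from (before⇔backward (σ₁ triple)))
    last′ : IsLast D (π σ₂) v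
    last′ u = ≮⇒≥ (≤⇒≯ (last ∈⊤) ∘ Equivalence.from (before⇔backward (σ₂ triple)))

lemma1 : ∀ {n : ℕ} (D : OrientedGraph n) →
    MaxDegreeAtMost D 4 → NoComponentTwoRegular D →
    (v : Fin n) → Unbalanced D v →
    Σ (Ordering D) λ σ₁ → Σ (Ordering D) λ σ₂ → Σ (Ordering D) λ σ₃ →
      VTriple D v σ₁ σ₂ σ₃
lemma1 {n} D md noReg v unb =
  toVTriple (vTripleOn n (≤-reflexive (∣⊤∣≡n n)) (maxDegreeIn⊤ md) (noTwoRegularComponentIn⊤ noReg)
                       ∈⊤ (unbalancedIn⊤ unb))
  where open Digraph D
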